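{- Let $w$ be a positive integer and $b_1,\dots,b_n$ positive integers with $\gcd(b_1,\dots,b_n) = 1$. Then \[ g(w,(b_i)_i) = \mu^2(2w)\prod_{p \mid w}\Sigma(p)\prod_{m=1}^n \prod_{\substack{p > 2 \\ p \mid b_i\ \forall i \neq m \\ p \nmid b_m w}} \Sigma_m(p). \] In particular, if moreover $w'$ and $b_1',\dots,b_n'$ are positive integers with $\gcd(b_1',\dots,b_n') = 1$ and $w\prod_{i=1}^n b_i$ is coprime to $w'\prod_{i=1}^n b_i'$, then $g(ww',(b_ib_i')_i) = g(w,(b_i)_i)\,g(w',(b_i')_i)$.
   Context: Setting: integers $n \geq 2$, $m \geq 1$ and squarefree monomials $M_{i,j}(t_1,\dots,t_n)$ ($i \in [m]$, $j \in \{1,2,3\}$, $[n]=\{1,\dots,n\}$) with leading coefficient $\pm1$, with $M_{i,1},M_{i,2},M_{i,3}$ pairwise coprime for each $i$. View $\mathcal{P}([n]\cup\{ -\})$ ($-$ a formal symbol) as an $\mathbb{F}_2$-vector space under symmetric difference $+$. Encode a monomial $\pm\prod_{l\in S'}t_l$ as $S'$ (sign $+$) or $S'\cup\{ -\}$ (sign $-$); let $S_{i,k}$ encode $M_{i,k}$. For $j\in[n]$ put $g_{i,\{j\}} = \varnothing$ if $j\notin S_{i,1}\cup S_{i,2}\cup S_{i,3}$, and $g_{i,\{j\}} = \{ -\}+S_{i,k'}+S_{i,k''}$ if $j \in S_{i,k}$ where $\{k,k',k''\}=\{1,2,3\}$. Let $V_{\{j\}}$ be the span of $\{g_{i,\{j\}}: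 i\in[m]\}$; let $W_{\{j\}} = V_{\{j\}}$ if $\{ -\}\notin V_{\{j\}}$ and $W_{\{j\}} = \{T\in V_{\{j\}} : -\notin T\}$ otherwise. Put $c_j = |W_{\{j\}}|$, and for an odd prime $p$ let $h_j(p) = 1$ if $p\equiv 1\bmod 4$ and $h_j(p) = \mathbf{1}_{\{ -\}\notin V_{\{j\}}}$ if $p \equiv 3 \bmod 4$. Define for odd primes $p$ \[ \Sigma(p) = \Big(1+\frac1p\sum_{j=1}^n\frac{h_j(p)}{c_j}\Big)^{ -1},\qquad \Sigma_m(p) = \Sigma(p)\Big(1+\frac1p\sum_{j\in[n],\, j\neq m}\frac{h_j(p)}{c_j}\Big), \] and for positive integers $d_1,\dots,d_n$, $\mathbf{F}(d_1,\dots,d_n) = \prod_{p\mid d_1\cdots d_n,\ p>2}\Sigma(p)\big(1+\frac1p\sum_{i\in[n],\,p\nmid d_i}\frac{h_i(p)}{c_i}\big)$. Finally $g(w,(b_i)_i) = \mathbf{F}(d_1,\dots,d_n)\mu^2(2w)$ with $d_j = w\cdot\gcd(\{b_i : i\in[n]\setminus\{j\}\})$. $\mu$ is the Möbius function. -}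

module Defs where

open import Data.Nat as ℕ using (ℕ; zero; suc; _≤_; _<_; _%_)
open import Data.Nat.Divisibility using (_∣?_)
open import Data.Bool.ListAction using (any; all)
open import Data.Nat.GCD using (gcd)
open import Data.Nat.Primality using (prime?)
open import Data.Fin as Fin using (Fin)
open import Data.Fin.Subset using (Subset; _∈_; _∉_)
open import Data.Vec as Vec using (Vec; []; _∷_; lookup; zipWith; replicate)
open import Data.Bool using (Bool; true; false; if_then_else_; _∧_; _∨_; not; _xor_)
open import Data.List as List using (List; []; _∷_; allFin; upTo; filterᵇ; length; map; _++_)
open import Data.Product using (_×_; _,_; proj₁; proj₂)
open import Data.Integer using (+_)
open import Data.Rational as ℚ using (ℚ; 0ℚ; 1ℚ)
import Data.Rational.Properties as ℚP
open import Relation.Nullary using (yes; no; does)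
open import Relation.Binary.PropositionalEquality using (_≡_; _≢_)

-- P([n] ∪ {-}) as an F₂-vector space: (S , s) encodes S ∪ {-} if s = true,
-- and S otherwise.  Addition is symmetric difference.

Elt : ℕ → Set
Elt n = Subset n × Bool

_⊕_ : ∀ {n} → Elt n → Elt n → Elt n
(S , a) ⊕ (T , b) = zipWith _xor_ S T , a xor b

∅E : ∀ {n} → Elt n
∅E {n} = replicate n false , false

minusE : ∀ {n} → Elt n
minusE {n} = replicate n false , true

eqVecᵇ : ∀ {k} → Vec Bool k → Vec Bool k → Bool
eqVecᵇ [] [] = true
eqVecᵇ (x ∷ xs) (y ∷ ys) = not (x xor y) ∧ eqVecᵇ xs ys

eqEᵇ : ∀ {n} → Elt n → Elt n → Bool
eqEᵇ (S , a) (T , b) = eqVecᵇ S T ∧ not (a xor b)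

allVecs : (k : ℕ) → List (Vec Bool k)
allVecs zero = [] ∷ []
allVecs (suc k) = map (true ∷_) (allVecs k) ++ map (false ∷_) (allVecs k)

allElts : (n : ℕ) → List (Elt n)
allElts n = map (_, true) (allVecs n) ++ map (_, false) (allVecs n)

sumSel : ∀ {n m} → Subset m → (Fin m → Elt n) → Elt n
sumSel {m = zero} [] v = ∅E
sumSel {m = suc m} (a ∷ A) v =
  (if a then v Fin.zero else ∅E) ⊕ sumSel A (λ i → v (Fin.suc i))

inSpanᵇ : ∀ {n m} → (Fin m → Elt n) → Elt n → Bool
inSpanᵇ {m = m} v T = any (λ A → eqEᵇ (sumSel A v) T) (allVecs m)

-- Monomial data: S i k encodes M_{i,k} (k ∈ {1,2,3} as Fin 3).

Monomials : ℕ → ℕ → Set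
Monomials n m = Fin m → Fin 3 → Elt n

-- M_{i,1}, M_{i,2}, M_{i,3} pairwise coprime (disjoint variable supports)
PairwiseCoprime : ∀ {n m} → Monomials n m → Set
PairwiseCoprime {n} {m} S =
  ∀ (i : Fin m) (k k' : Fin 3) → k ≢ k' →
    ∀ (j : Fin n) → j ∈ proj₁ (S i k) → j ∉ proj₁ (S i k')

k1 k2 k3 : Fin 3
k1 = Fin.zero
k2 = Fin.suc Fin.zero
k3 = Fin.suc (Fin.suc Fin.zero)

gvec : ∀ {n m} → Monomials n m → Fin m → Fin n → Elt n
gvec S i j =
  if lookup (proj₁ (S i k1)) j then minusE ⊕ (S i k2 ⊕ S i k3) else
  if lookup (proj₁ (S i k2)) j then minusE ⊕ (S i k1 ⊕ S i k3) else
  if lookup (proj₁ (S i k3)) j then minusE ⊕ (S i k1 ⊕ S i k2) else ∅E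

inVᵇ : ∀ {n m} → Monomials n m → Fin n → Elt n → Bool
inVᵇ S j = inSpanᵇ (λ i → gvec S i j)

minusInVᵇ : ∀ {n m} → Monomials n m → Fin n → Bool
minusInVᵇ S j = inVᵇ S j minusE

inWᵇ : ∀ {n m} → Monomials n m → Fin n → Elt n → Bool
inWᵇ S j T = inVᵇ S j T ∧ (if minusInVᵇ S j then not (proj₂ T) else true)

cc : ∀ {n m} → Monomials n m → Fin n → ℕ
cc {n} S j = length (filterᵇ (inWᵇ S j) (allElts n))

-- h_j(p)  (p odd prime: p ≡ 1 mod 4, else p ≡ 3 mod 4)
hh : ∀ {n m} → Monomials n m → Fin n → ℕ → ℕ
hh S j p with p % 4
... | 1 = 1
... | _ = if minusInVᵇ S j then 0 else 1

-- a / b  (only ever used with b ≠ 0; value 0 when b = 0)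
frac : ℕ → ℕ → ℚ
frac a zero = 0ℚ
frac a (suc b) = (+ a) ℚ./ suc b

-- multiplicative inverse (only ever used on nonzero arguments; 0⁻¹ := 0)
inv : ℚ → ℚ
inv q with q ℚP.≟ 0ℚ
... | yes _ = 0ℚ
... | no q≢0 = ℚ.1/_ q {{ℚ.≢-nonZero q≢0}}

sumℚ : List ℚ → ℚ
sumℚ = List.foldr ℚ._+_ 0ℚ

prodℚ : List ℚ → ℚ
prodℚ = List.foldr ℚ._*_ 1ℚ

onePlus : ∀ {n m} → Monomials n m → ℕ → (Fin n → Bool) → ℚ
onePlus {n} S p P =
  1ℚ ℚ.+ frac 1 p ℚ.* sumℚ (map (λ j → frac (hh S j p) (cc S j)) (filterᵇ P (allFin n)))

Sig : ∀ {n m} → Monomials n m → ℕ → ℚ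
Sig S p = inv (onePlus S p (λ _ → true))

eqFinᵇ : ∀ {n} → Fin n → Fin n → Bool
eqFinᵇ i j = does (i Fin.≟ j)

Sigm : ∀ {n m} → Monomials n m → Fin n → ℕ → ℚ
Sigm S mm p = Sig S p ℚ.* onePlus S p (λ j → not (eqFinᵇ j mm))

divᵇ : ℕ → ℕ → Bool
divᵇ a b = does (a ∣? b)

primeᵇ : ℕ → Bool
primeᵇ p = does (prime? p)

prodOddPrimes : ℕ → (ℕ → Bool) → (ℕ → ℚ) → ℚ
prodOddPrimes B P f =
  prodℚ (map f (filterᵇ (λ p → primeᵇ p ∧ does (3 ℕ.≤? p) ∧ P p) (upTo (suc B))))

mu2 : ℕ → ℚ
mu2 x = if any (λ d → does (2 ℕ.≤? d) ∧ divᵇ (d ℕ.* d) x) (upTo (suc x)) then 0ℚ else 1ℚ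

prodℕ : ∀ {n} → (Fin n → ℕ) → ℕ
prodℕ {n} b = List.foldr ℕ._*_ 1 (map b (allFin n))

-- gcd of {b i : P i}  (gcd of the empty family is 0)
gcdOver : ∀ {n} → (Fin n → Bool) → (Fin n → ℕ) → ℕ
gcdOver {n} P b = List.foldr gcd 0 (map b (filterᵇ P (allFin n)))

FF : ∀ {n m} → Monomials n m → (Fin n → ℕ) → ℚ
FF {n} S d =
  prodOddPrimes (prodℕ d) (λ p → divᵇ p (prodℕ d))
    (λ p → Sig S p ℚ.* onePlus S p (λ i → not (divᵇ p (d i))))

gg : ∀ {n m} → Monomials n m → ℕ → (Fin n → ℕ) → ℚ
gg S w b = FF S (λ j → w ℕ.* gcdOver (λ i → not (eqFinᵇ i j)) b) ℚ.* mu2 (2 ℕ.* w)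

rhs : ∀ {n m} → Monomials n m → ℕ → (Fin n → ℕ) → ℚ
rhs {n} S w b =
  mu2 (2 ℕ.* w)
  ℚ.* prodOddPrimes w (λ p → divᵇ p w) (Sig S)
  ℚ.* prodℚ (map (λ mm →
        prodOddPrimes (prodℕ b)
          (λ p → all (λ i → divᵇ p (b i)) (filterᵇ (λ i → not (eqFinᵇ i mm)) (allFin n))
                 ∧ not (divᵇ p (b mm ℕ.* w)))
          (Sigm S mm))
      (allFin n))

-- Apart from μ²(2w), both sides are products of local factors over odd primes, so they are compared
-- one prime at a time after extending all products to the primes below a common bound. The factor of
-- 𝐅(d₁, …, dₙ) at p only depends on which d_j are divisible by p. For d_j = w · gcd {b_i : i ≠ j}
-- with gcd b = 1: if p ∣ w then p divides every d_j and the factor is Σ(p); otherwise p divides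
-- d_j exactly when p ∣ b_i for all i ≠ j, which (as p cannot divide every b_i) happens for at most
-- one j, and the factor is Σ_j(p). For multiplicativity, a prime dividing the data of one side is
-- prime to the data of the other, so each local factor of 𝐅 comes from one side only; and a prime
-- square dividing 2ww′ with w, w′ coprime already divides 2w or 2w′.

{-# OPTIONS --safe #-}
module Submission where

open import Defs
open import Data.Nat using (ℕ; _≤_; _<_)
open import Data.Nat.Coprimality using (Coprime)
open import Data.Fin using (Fin)
open import Data.Product using (_×_)
open import Data.Bool using (true)
open import Data.Rational using (ℚ; _*_)
open import Relation.Binary.PropositionalEquality using (_≡_)

open import Algebra.Bundles using (CommutativeMonoid)
open import Data.Bool using (Bool; false; T; not; _∧_; _∨_; if_then_else_)
open import Data.Bool.ListAction using (any; all)
open import Data.Bool.Properties using (T-∧; T-∨)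
open import Data.Fin as Fin using (zero; suc; _≟_)
open import Data.Fin.Properties using (suc-injective)
open import Data.List using (List; []; _∷_; _++_; map; filterᵇ; foldr; allFin; upTo; tabulate)
import Data.List.Properties as List
open import Data.List.Membership.Propositional using (find; lose)
open import Data.List.Membership.Propositional.Properties
  using (∈-allFin; ∈-upTo⁺; ∈-filter⁺; ∈-filter⁻; ∈-map⁺)
open import Data.List.Relation.Unary.All as All using (All; []; _∷_)
import Data.List.Relation.Unary.All.Properties as All
open import Data.List.Relation.Unary.Any as Any using (Any; here; there)
import Data.List.Relation.Unary.Any.Properties as Any
open import Data.Nat as ℕ using (zero; suc; z≤n; s≤s; _≤′_)
import Data.Nat.Properties as ℕₚ
open import Data.Nat.Coprimality using (coprime-divisor)
open import Data.Nat.Divisibility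
  using (_∣_; _∣?_; _∣0; ∣-refl; ∣-trans; ∣⇒≤; ∣1⇒≡1; 0∣⇒≡0; ∣m⇒∣m*n; ∣n⇒∣m*n; m∣m*n; n∣m*n
        ; *-pres-∣; *-monoʳ-∣)
open import Data.Nat.GCD using (gcd; gcd[m,n]∣m; gcd[m,n]∣n; gcd-greatest)
open import Data.Nat.ListAction using (product)
open import Data.Nat.ListAction.Properties using (∈⇒∣product; product≢0)
open import Data.Nat.Primality
  using (Prime; prime?; ¬prime[1]; euclidsLemma; prime⇒irreducible; prime⇒nonZero; prime⇒nonTrivial)
open import Data.Nat.Primality.Factorisation using (factorise)
open import Data.Product using (∃-syntax; _,_; proj₁; proj₂)
open import Data.Rational using (0ℚ; 1ℚ; _+_)
import Data.Rational.Properties as ℚₚ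
open import Data.Sum as Sum using (_⊎_; inj₁; inj₂; [_,_]′)
open import Data.Unit using (tt)
open import Data.Empty using (⊥-elim)
open import Function using (_∘_; const; id; flip)
open import Function.Bundles using (_⇔_; mk⇔; Equivalence)
open import Relation.Nullary using (Dec; yes; no; does; ¬_; contradiction; T?)
open import Relation.Nullary.Decidable using (dec-true; does-⇔; _×-dec_; decidable-stable)
open import Relation.Binary.PropositionalEquality
  using (_≢_; refl; sym; trans; cong; cong₂; subst; module ≡-Reasoning)
open import Algebra.Properties.CommutativeSemigroup
  (CommutativeMonoid.commutativeSemigroup ℚₚ.*-1-commutativeMonoid) using (interchange)
import Algebra.Properties.CommutativeSemigroup ℕₚ.*-commutativeSemigroup as ℕ*

open Equivalence using (to; from)
open ≡-Reasoning

T-does : ∀ {a} {A : Set a} (a? : Dec A) → T (does a?) ⇔ A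
T-does (yes a) = mk⇔ (const a) (const tt)
T-does (no ¬a) = mk⇔ (λ ()) ¬a

T-not-does : ∀ {a} {A : Set a} (a? : Dec A) → T (not (does a?)) ⇔ (¬ A)
T-not-does (yes a) = mk⇔ (λ ()) (λ ¬a → ¬a a)
T-not-does (no ¬a) = mk⇔ (const ¬a) (const tt)

T-injective : ∀ {a b} → T a ⇔ T b → a ≡ b
T-injective {false} {false} _ = refl
T-injective {false} {true}  a⇔b = contradiction tt (from a⇔b)
T-injective {true}  {false} a⇔b = contradiction tt (to a⇔b)
T-injective {true}  {true}  _ = refl

if-T : ∀ {A : Set} {c} {x y : A} → T c → (if c then x else y) ≡ x
if-T {c = true} _ = refl

if-¬T : ∀ {A : Set} {c} {x y : A} → ¬ T c → (if c then x else y) ≡ y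
if-¬T {c = false} _ = refl
if-¬T {c = true}  ¬c = contradiction tt ¬c

T-divᵇ : ∀ {p x} → T (divᵇ p x) ⇔ p ∣ x
T-divᵇ {p} {x} = T-does (p ∣? x)

prodℚ-++ : ∀ (xs ys : List ℚ) → prodℚ (xs ++ ys) ≡ prodℚ xs * prodℚ ys
prodℚ-++ []       ys = sym (ℚₚ.*-identityˡ _)
prodℚ-++ (x ∷ xs) ys = trans (cong (x *_) (prodℚ-++ xs ys)) (sym (ℚₚ.*-assoc x _ _))

module _ {A : Set} where

  prodℚ-map-cong : ∀ {f g : A → ℚ} → (∀ x → f x ≡ g x) → ∀ xs → prodℚ (map f xs) ≡ prodℚ (map g xs)
  prodℚ-map-cong f≗g xs = cong prodℚ (List.map-cong f≗g xs)

  prodℚ-map-1 : ∀ {f : A → ℚ} → (∀ x → f x ≡ 1ℚ) → ∀ xs → prodℚ (map f xs) ≡ 1ℚ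
  prodℚ-map-1 f≗1 []       = refl
  prodℚ-map-1 f≗1 (x ∷ xs) = cong₂ _*_ (f≗1 x) (prodℚ-map-1 f≗1 xs)

  prodℚ-map-* : ∀ (f g : A → ℚ) xs →
    prodℚ (map (λ x → f x * g x) xs) ≡ prodℚ (map f xs) * prodℚ (map g xs)
  prodℚ-map-* f g []       = refl
  prodℚ-map-* f g (x ∷ xs) =
    trans (cong (f x * g x *_) (prodℚ-map-* f g xs)) (interchange (f x) (g x) _ _)

  prodℚ-map-filterᵇ : ∀ (P : A → Bool) (f : A → ℚ) xs →
    prodℚ (map f (filterᵇ P xs)) ≡ prodℚ (map (λ x → if P x then f x else 1ℚ) xs)
  prodℚ-map-filterᵇ P f []       = refl
  prodℚ-map-filterᵇ P f (x ∷ xs) with P x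
  ... | true  = cong (f x *_) (prodℚ-map-filterᵇ P f xs)
  ... | false = trans (prodℚ-map-filterᵇ P f xs) (sym (ℚₚ.*-identityˡ _))

prodℚ-map-swap : ∀ {A B : Set} (f : A → B → ℚ) xs ys →
  prodℚ (map (λ x → prodℚ (map (f x) ys)) xs) ≡ prodℚ (map (λ y → prodℚ (map (λ x → f x y) xs)) ys)
prodℚ-map-swap f []       ys = sym (prodℚ-map-1 (λ _ → refl) ys)
prodℚ-map-swap f (x ∷ xs) ys =
  trans (cong (prodℚ (map (f x) ys) *_) (prodℚ-map-swap f xs ys)) (sym (prodℚ-map-* (f x) _ ys))

prodℚ-tabulate-single : ∀ {n} (f : Fin n → ℚ) j → (∀ i → i ≢ j → f i ≡ 1ℚ) →
  prodℚ (tabulate f) ≡ f j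
prodℚ-tabulate-single {suc n} f zero    f≗1 = begin
  f zero * prodℚ (tabulate (f ∘ suc))
    ≡⟨ cong (λ xs → f zero * prodℚ xs) (List.map-tabulate id (f ∘ suc)) ⟨
  f zero * prodℚ (map (f ∘ suc) (allFin n))
    ≡⟨ cong (f zero *_) (prodℚ-map-1 (λ i → f≗1 (suc i) λ ()) (allFin n)) ⟩
  f zero * 1ℚ
    ≡⟨ ℚₚ.*-identityʳ _ ⟩
  f zero ∎
prodℚ-tabulate-single {suc n} f (suc j) f≗1 = begin
  f zero * prodℚ (tabulate (f ∘ suc))
    ≡⟨ cong₂ _*_ (f≗1 zero λ ()) (prodℚ-tabulate-single (f ∘ suc) j λ i i≢j → f≗1 (suc i) (i≢j ∘ suc-injective)) ⟩
  1ℚ * f (suc j)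
    ≡⟨ ℚₚ.*-identityˡ _ ⟩
  f (suc j) ∎

prodℚ-allFin-single : ∀ {n} (f : Fin n → ℚ) j → (∀ i → i ≢ j → f i ≡ 1ℚ) →
  prodℚ (map f (allFin n)) ≡ f j
prodℚ-allFin-single f j f≗1 = trans (cong prodℚ (List.map-tabulate id f)) (prodℚ-tabulate-single f j f≗1)

prodUpTo : ℕ → (ℕ → ℚ) → ℚ
prodUpTo N f = prodℚ (map f (upTo (suc N)))

prodUpTo-suc : ∀ N f → prodUpTo (suc N) f ≡ prodUpTo N f * f (suc N)
prodUpTo-suc N f = begin
  prodℚ (map f (upTo (suc (suc N))))             ≡⟨ cong (prodℚ ∘ map f) (List.upTo-∷ʳ (suc N)) ⟨
  prodℚ (map f (upTo (suc N) ++ suc N ∷ []))     ≡⟨ cong prodℚ (List.map-++ f (upTo (suc N)) _) ⟩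
  prodℚ (map f (upTo (suc N)) ++ f (suc N) ∷ []) ≡⟨ prodℚ-++ (map f (upTo (suc N))) _ ⟩
  prodUpTo N f * (f (suc N) * 1ℚ)                ≡⟨ cong (prodUpTo N f *_) (ℚₚ.*-identityʳ _) ⟩
  prodUpTo N f * f (suc N)                       ∎

prodUpTo-extend : ∀ {B N} f → (∀ p → B < p → f p ≡ 1ℚ) → B ≤ N → prodUpTo B f ≡ prodUpTo N f
prodUpTo-extend {B} f f≗1 B≤N = go (ℕₚ.≤⇒≤′ B≤N)
  where
  go : ∀ {N} → B ≤′ N → prodUpTo B f ≡ prodUpTo N f
  go ℕ.≤′-refl = refl
  go (ℕ.≤′-step {N} B≤′N) = begin
    prodUpTo B f              ≡⟨ go B≤′N ⟩
    prodUpTo N f              ≡⟨ ℚₚ.*-identityʳ _ ⟨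
    prodUpTo N f * 1ℚ         ≡⟨ cong (prodUpTo N f *_) (f≗1 (suc N) (s≤s (ℕₚ.≤′⇒≤ B≤′N))) ⟨
    prodUpTo N f * f (suc N)  ≡⟨ prodUpTo-suc N f ⟨
    prodUpTo (suc N) f        ∎

OddPrime : ℕ → Set
OddPrime p = Prime p × 3 ≤ p

oddPrime? : ∀ p → Dec (OddPrime p)
oddPrime? p = prime? p ×-dec (3 ℕ.≤? p)

eulerCondition : (ℕ → Bool) → ℕ → Bool
eulerCondition P p = primeᵇ p ∧ does (3 ℕ.≤? p) ∧ P p

T-eulerCondition : ∀ P p → T (eulerCondition P p) → OddPrime p × T (P p)
T-eulerCondition P p t =
  let prime , t′ = to (T-∧ {primeᵇ p}) t
      3≤p , Pp = to (T-∧ {does (3 ℕ.≤? p)}) t′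
  in (to (T-does (prime? p)) prime , to (T-does (3 ℕ.≤? p)) 3≤p) , Pp

eulerFactor : (ℕ → Bool) → (ℕ → ℚ) → ℕ → ℚ
eulerFactor P f p = if eulerCondition P p then f p else 1ℚ

eulerFactor-oddPrime : ∀ {p} P f → OddPrime p → eulerFactor P f p ≡ (if P p then f p else 1ℚ)
eulerFactor-oddPrime {p} P f (pr , 3≤p) =
  cong₂ (λ a b → if a ∧ b ∧ P p then f p else 1ℚ) (dec-true (prime? p) pr) (dec-true (3 ℕ.≤? p) 3≤p)

eulerFactor-¬oddPrime : ∀ {p} P f → ¬ OddPrime p → eulerFactor P f p ≡ 1ℚ
eulerFactor-¬oddPrime {p} P f ¬odd = if-¬T (¬odd ∘ proj₁ ∘ T-eulerCondition P p)

prodOddPrimes≡prodUpTo : ∀ {B} N P f → (∀ p → T (P p) → p ≤ B) → B ≤ N →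
  prodOddPrimes B P f ≡ prodUpTo N (eulerFactor P f)
prodOddPrimes≡prodUpTo {B} N P f P⇒≤B B≤N = begin
  prodOddPrimes B P f          ≡⟨ prodℚ-map-filterᵇ (eulerCondition P) f (upTo (suc B)) ⟩
  prodUpTo B (eulerFactor P f) ≡⟨ prodUpTo-extend (eulerFactor P f) beyond B≤N ⟩
  prodUpTo N (eulerFactor P f) ∎
  where
  beyond : ∀ p → B < p → eulerFactor P f p ≡ 1ℚ
  beyond p B<p = if-¬T (ℕₚ.<⇒≱ B<p ∘ P⇒≤B p ∘ proj₂ ∘ T-eulerCondition P p)

*-pos : ∀ {m n} → 0 < m → 0 < n → 0 < m ℕ.* n
*-pos (s≤s z≤n) (s≤s z≤n) = s≤s z≤n

∣-pos : ∀ {m n} → m ∣ n → 0 < n → 0 < m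
∣-pos {zero} 0∣n n>0 = contradiction (0∣⇒≡0 0∣n) (ℕₚ.>⇒≢ n>0)
∣-pos {suc _} _ _ = s≤s z≤n

∣foldr-gcd⇔ : ∀ {d} ns → d ∣ foldr gcd 0 ns ⇔ All (d ∣_) ns
∣foldr-gcd⇔ []       = mk⇔ (const []) (const (_ ∣0))
∣foldr-gcd⇔ (n ∷ ns) = mk⇔
  (λ d∣g → ∣-trans d∣g (gcd[m,n]∣m n _) ∷ to (∣foldr-gcd⇔ ns) (∣-trans d∣g (gcd[m,n]∣n n _)))
  (λ { (d∣n ∷ d∣ns) → gcd-greatest d∣n (from (∣foldr-gcd⇔ ns) d∣ns) })

All-filterᵇ-allFin⇔ : ∀ {n ℓ} {Q : Fin n → Set ℓ} (P : Fin n → Bool) →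
  All Q (filterᵇ P (allFin n)) ⇔ (∀ i → T (P i) → Q i)
All-filterᵇ-allFin⇔ P = mk⇔
  (λ Qs i Pi → All.lookup Qs (∈-filter⁺ (T? ∘ P) (∈-allFin i) Pi))
  (λ Q⇐P → All.tabulate λ i∈ → Q⇐P _ (proj₂ (∈-filter⁻ (T? ∘ P) {xs = allFin _} i∈)))

∣gcdOver⇔ : ∀ {n d} (P : Fin n → Bool) (b : Fin n → ℕ) →
  d ∣ gcdOver P b ⇔ (∀ i → T (P i) → d ∣ b i)
∣gcdOver⇔ P b = mk⇔
  (to (All-filterᵇ-allFin⇔ P) ∘ All.map⁻ ∘ to (∣foldr-gcd⇔ _))
  (from (∣foldr-gcd⇔ _) ∘ All.map⁺ ∘ from (All-filterᵇ-allFin⇔ P))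

∣prodℕ : ∀ {n} (b : Fin n → ℕ) i → b i ∣ prodℕ b
∣prodℕ b i = ∈⇒∣product (∈-map⁺ b (∈-allFin i))

prodℕ-pos : ∀ {n} (b : Fin n → ℕ) → (∀ i → 0 < b i) → 0 < prodℕ b
prodℕ-pos {n} b b>0 =
  ℕ.>-nonZero⁻¹ _ {{product≢0 (All.map⁺ {xs = allFin n} (All.tabulate λ {i} _ → ℕ.>-nonZero (b>0 i)))}}

prime∣product⇒ : ∀ {p} ns → Prime p → p ∣ product ns → Any (p ∣_) ns
prime∣product⇒ []       pr p∣1 = contradiction (subst Prime (∣1⇒≡1 p∣1) pr) ¬prime[1]
prime∣product⇒ (n ∷ ns) pr p∣n*ns =
  [ here , there ∘ prime∣product⇒ ns pr ]′ (euclidsLemma n (product ns) pr p∣n*ns)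

prime∣prodℕ⇔ : ∀ {n p} (b : Fin n → ℕ) → Prime p → p ∣ prodℕ b ⇔ (∃[ i ] p ∣ b i)
prime∣prodℕ⇔ {n} b pr = mk⇔
  (Any.satisfied ∘ Any.map⁻ ∘ prime∣product⇒ (map b (allFin n)) pr)
  (λ (i , p∣bi) → ∣-trans p∣bi (∣prodℕ b i))

-- The local factors of 𝐅

module _ {n m} (S : Monomials n m) where

  FFterm : (Fin n → ℕ) → ℕ → ℚ
  FFterm d p = Sig S p * onePlus S p (λ i → not (divᵇ p (d i)))

  FFlocal : (Fin n → ℕ) → ℕ → ℚ
  FFlocal d p = if divᵇ p (prodℕ d) then FFterm d p else 1ℚ

  onePlus-over : ℕ → List (Fin n) → ℚ
  onePlus-over p js = 1ℚ + frac 1 p * sumℚ (map (λ j → frac (hh S j p) (cc S j)) js)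

  onePlus-cong : ∀ p {P Q : Fin n → Bool} → (∀ i → P i ≡ Q i) → onePlus S p P ≡ onePlus S p Q
  onePlus-cong p {P} {Q} P≗Q = cong (onePlus-over p)
    (List.filter-≐ (T? ∘ P) (T? ∘ Q) ((λ {i} → subst T (P≗Q i)) , (λ {i} → subst T (sym (P≗Q i)))) (allFin n))

  onePlus-none : ∀ p {P : Fin n → Bool} → (∀ i → ¬ T (P i)) → onePlus S p P ≡ 1ℚ
  onePlus-none p {P} ¬P = begin
    onePlus-over p (filterᵇ P (allFin n))
      ≡⟨ cong (onePlus-over p) (List.filter-none (T? ∘ P) {xs = allFin n} (All.tabulate λ {i} _ → ¬P i)) ⟩
    1ℚ + frac 1 p * 0ℚ                    ≡⟨ cong (1ℚ +_) (ℚₚ.*-zeroʳ (frac 1 p)) ⟩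
    1ℚ + 0ℚ                               ≡⟨ ℚₚ.+-identityʳ 1ℚ ⟩
    1ℚ                                    ∎

  FFlocal-cong : ∀ {p d e} → Prime p → (∀ i → p ∣ d i ⇔ p ∣ e i) → FFlocal d p ≡ FFlocal e p
  FFlocal-cong {p} {d} {e} pr d⇔e =
    cong₂ (λ c x → if c then Sig S p * x else 1ℚ)
      (does-⇔ ∏d⇔∏e (p ∣? prodℕ d) (p ∣? prodℕ e))
      (onePlus-cong p λ i → cong not (does-⇔ (d⇔e i) (p ∣? d i) (p ∣? e i)))
    where
    ∣prodℕ-transfer : ∀ d e → (∀ i → p ∣ d i → p ∣ e i) → p ∣ prodℕ d → p ∣ prodℕ e
    ∣prodℕ-transfer d e d⇒e p∣∏d =
      let i , p∣di = to (prime∣prodℕ⇔ d pr) p∣∏d in from (prime∣prodℕ⇔ e pr) (i , d⇒e i p∣di)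
    ∏d⇔∏e : p ∣ prodℕ d ⇔ p ∣ prodℕ e
    ∏d⇔∏e = mk⇔ (∣prodℕ-transfer d e (to ∘ d⇔e)) (∣prodℕ-transfer e d (from ∘ d⇔e))

  FFlocal-coprime : ∀ {p d} → Prime p → (∀ i → ¬ p ∣ d i) → FFlocal d p ≡ 1ℚ
  FFlocal-coprime {p} {d} pr p∤d = if-¬T λ t → let i , p∣di = to (prime∣prodℕ⇔ d pr) (to T-divᵇ t) in p∤d i p∣di

  FFlocal-all : ∀ {p d} → (∀ i → p ∣ d i) → Fin n → FFlocal d p ≡ Sig S p
  FFlocal-all {p} {d} p∣d i₀ = begin
    FFlocal d p        ≡⟨ if-T (from T-divᵇ (∣-trans (p∣d i₀) (∣prodℕ d i₀))) ⟩
    FFterm d p         ≡⟨ cong (Sig S p *_) (onePlus-none p λ i → flip (to (T-not-does (p ∣? d i))) (p∣d i)) ⟩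
    Sig S p * 1ℚ       ≡⟨ ℚₚ.*-identityʳ _ ⟩
    Sig S p            ∎

  FFlocal-single : ∀ {p d j} → (∀ i → p ∣ d i ⇔ i ≡ j) → FFlocal d p ≡ Sigm S j p
  FFlocal-single {p} {d} {j} d⇔j = begin
    FFlocal d p   ≡⟨ if-T (from T-divᵇ (∣-trans (from (d⇔j j) refl) (∣prodℕ d j))) ⟩
    FFterm d p    ≡⟨ cong (Sig S p *_) (onePlus-cong p λ i → cong not (does-⇔ (d⇔j i) (p ∣? d i) (i ≟ j))) ⟩
    Sigm S j p    ∎

  FFlocal-* : ∀ {p d e f} → Prime p → ¬ (p ∣ prodℕ e × p ∣ prodℕ f) →
    (∀ i → p ∣ d i ⇔ (p ∣ e i ⊎ p ∣ f i)) → FFlocal d p ≡ FFlocal e p * FFlocal f p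
  FFlocal-* {p} {d} {e} {f} pr no-common d⇔e⊎f = split (p ∣? prodℕ e)
    where
    split : Dec (p ∣ prodℕ e) → FFlocal d p ≡ FFlocal e p * FFlocal f p
    split (yes p∣∏e) = begin
      FFlocal d p                ≡⟨ FFlocal-cong pr d⇔e ⟩
      FFlocal e p                ≡⟨ ℚₚ.*-identityʳ _ ⟨
      FFlocal e p * 1ℚ           ≡⟨ cong (FFlocal e p *_) (FFlocal-coprime pr p∤f) ⟨
      FFlocal e p * FFlocal f p  ∎
      where
      p∤f : ∀ i → ¬ p ∣ f i
      p∤f i p∣fi = no-common (p∣∏e , ∣-trans p∣fi (∣prodℕ f i))
      d⇔e : ∀ i → p ∣ d i ⇔ p ∣ e i
      d⇔e i = mk⇔ ([ id , ⊥-elim ∘ p∤f i ]′ ∘ to (d⇔e⊎f i)) (from (d⇔e⊎f i) ∘ inj₁)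
    split (no p∤∏e) = begin
      FFlocal d p                ≡⟨ FFlocal-cong pr d⇔f ⟩
      FFlocal f p                ≡⟨ ℚₚ.*-identityˡ _ ⟨
      1ℚ * FFlocal f p           ≡⟨ cong (_* FFlocal f p) (FFlocal-coprime pr p∤e) ⟨
      FFlocal e p * FFlocal f p  ∎
      where
      p∤e : ∀ i → ¬ p ∣ e i
      p∤e i p∣ei = p∤∏e (∣-trans p∣ei (∣prodℕ e i))
      d⇔f : ∀ i → p ∣ d i ⇔ p ∣ f i
      d⇔f i = mk⇔ ([ ⊥-elim ∘ p∤e i , id ]′ ∘ to (d⇔e⊎f i)) (from (d⇔e⊎f i) ∘ inj₂)

  FFeuler : (Fin n → ℕ) → ℕ → ℚ
  FFeuler d = eulerFactor (λ p → divᵇ p (prodℕ d)) (FFterm d)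

  FFeuler-oddPrime : ∀ {p} d → OddPrime p → FFeuler d p ≡ FFlocal d p
  FFeuler-oddPrime d = eulerFactor-oddPrime (λ p → divᵇ p (prodℕ d)) (FFterm d)

  FFeuler-¬oddPrime : ∀ {p} d → ¬ OddPrime p → FFeuler d p ≡ 1ℚ
  FFeuler-¬oddPrime d = eulerFactor-¬oddPrime (λ p → divᵇ p (prodℕ d)) (FFterm d)

  FF≡prodUpTo : ∀ N d → 0 < prodℕ d → prodℕ d ≤ N → FF S d ≡ prodUpTo N (FFeuler d)
  FF≡prodUpTo N d ∏d>0 ∏d≤N =
    prodOddPrimes≡prodUpTo N _ (FFterm d) (λ p t → ∣⇒≤ {{ℕ.>-nonZero ∏d>0}} (to T-divᵇ t)) ∏d≤N

  FF-* : ∀ d e f → 0 < prodℕ d → 0 < prodℕ e → 0 < prodℕ f →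
    (∀ {p} → Prime p → ¬ (p ∣ prodℕ e × p ∣ prodℕ f)) →
    (∀ {p} → Prime p → ∀ i → p ∣ d i ⇔ (p ∣ e i ⊎ p ∣ f i)) →
    FF S d ≡ FF S e * FF S f
  FF-* d e f ∏d>0 ∏e>0 ∏f>0 no-common d⇔e⊎f = begin
    FF S d
      ≡⟨ FF≡prodUpTo N d ∏d>0 ∏d≤N ⟩
    prodUpTo N (FFeuler d)
      ≡⟨ prodℚ-map-cong local (upTo (suc N)) ⟩
    prodUpTo N (λ p → FFeuler e p * FFeuler f p)
      ≡⟨ prodℚ-map-* (FFeuler e) (FFeuler f) (upTo (suc N)) ⟩
    prodUpTo N (FFeuler e) * prodUpTo N (FFeuler f)
      ≡⟨ cong₂ _*_ (FF≡prodUpTo N e ∏e>0 ∏e≤N) (FF≡prodUpTo N f ∏f>0 ∏f≤N) ⟨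
    FF S e * FF S f ∎
    where
    N = prodℕ d ℕ.+ prodℕ e ℕ.+ prodℕ f
    ∏d≤N : prodℕ d ≤ N
    ∏d≤N = ℕₚ.≤-trans (ℕₚ.m≤m+n _ _) (ℕₚ.m≤m+n _ _)
    ∏e≤N : prodℕ e ≤ N
    ∏e≤N = ℕₚ.≤-trans (ℕₚ.m≤n+m _ (prodℕ d)) (ℕₚ.m≤m+n _ _)
    ∏f≤N : prodℕ f ≤ N
    ∏f≤N = ℕₚ.m≤n+m _ (prodℕ d ℕ.+ prodℕ e)
    local : ∀ p → FFeuler d p ≡ FFeuler e p * FFeuler f p
    local p with oddPrime? p
    ... | yes odd@(pr , _) = begin
      FFeuler d p                ≡⟨ FFeuler-oddPrime d odd ⟩
      FFlocal d p                ≡⟨ FFlocal-* pr (no-common pr) (d⇔e⊎f pr) ⟩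
      FFlocal e p * FFlocal f p  ≡⟨ cong₂ _*_ (FFeuler-oddPrime e odd) (FFeuler-oddPrime f odd) ⟨
      FFeuler e p * FFeuler f p  ∎
    ... | no ¬odd = begin
      FFeuler d p                ≡⟨ FFeuler-¬oddPrime d ¬odd ⟩
      1ℚ * 1ℚ                    ≡⟨ cong₂ _*_ (FFeuler-¬oddPrime e ¬odd) (FFeuler-¬oddPrime f ¬odd) ⟨
      FFeuler e p * FFeuler f p  ∎

-- The arguments d_j = w · gcd {b_i : i ≠ j} of 𝐅 in g(w, b)

others : ∀ {n} → Fin n → List (Fin n)
others {n} j = filterᵇ (λ i → not (eqFinᵇ i j)) (allFin n)

All-others⇔ : ∀ {n ℓ} {Q : Fin n → Set ℓ} j → All Q (others j) ⇔ (∀ i → i ≢ j → Q i)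
All-others⇔ j = mk⇔
  (λ Qs i i≢j → to (All-filterᵇ-allFin⇔ _) Qs i (from (T-not-does (i ≟ j)) i≢j))
  (λ Q⇐≢ → from (All-filterᵇ-allFin⇔ _) λ i t → Q⇐≢ i (to (T-not-does (i ≟ j)) t))

gcdOthers : ∀ {n} → (Fin n → ℕ) → Fin n → ℕ
gcdOthers b j = gcdOver (λ i → not (eqFinᵇ i j)) b

dVec : ∀ {n} → ℕ → (Fin n → ℕ) → Fin n → ℕ
dVec w b j = w ℕ.* gcdOthers b j

∣gcdOthers⇔ : ∀ {n d} (b : Fin n → ℕ) j → d ∣ gcdOthers b j ⇔ (∀ i → i ≢ j → d ∣ b i)
∣gcdOthers⇔ b j = mk⇔
  (to (All-others⇔ j) ∘ All.map⁻ ∘ to (∣foldr-gcd⇔ _))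
  (from (∣foldr-gcd⇔ _) ∘ All.map⁺ ∘ from (All-others⇔ j))

prime∣dVec⇔ : ∀ {n p} w (b : Fin n → ℕ) j → Prime p →
  p ∣ dVec w b j ⇔ (p ∣ w ⊎ (∀ i → i ≢ j → p ∣ b i))
prime∣dVec⇔ w b j pr = mk⇔
  ([ inj₁ , inj₂ ∘ to (∣gcdOthers⇔ b j) ]′ ∘ euclidsLemma w _ pr)
  [ ∣m⇒∣m*n _ , ∣n⇒∣m*n w ∘ from (∣gcdOthers⇔ b j) ]′

other : ∀ {n} → 2 ≤ n → (j : Fin n) → ∃[ i ] i ≢ j
other {suc (suc _)} _ zero    = suc zero , λ ()
other {suc (suc _)} _ (suc _) = zero , λ ()
other {suc zero}    (s≤s ()) _

dVec∣w*prodℕ : ∀ {n} → 2 ≤ n → ∀ w (b : Fin n → ℕ) j → dVec w b j ∣ w ℕ.* prodℕ b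
dVec∣w*prodℕ 2≤n w b j =
  let i , i≢j = other 2≤n j in *-monoʳ-∣ w (∣-trans (to (∣gcdOthers⇔ b j) ∣-refl i i≢j) (∣prodℕ b i))

∏dVec-pos : ∀ {n w} {b : Fin n → ℕ} → 2 ≤ n → 0 < w → (∀ i → 0 < b i) → 0 < prodℕ (dVec w b)
∏dVec-pos {w = w} {b} 2≤n w>0 b>0 =
  prodℕ-pos _ λ j → ∣-pos (dVec∣w*prodℕ 2≤n w b j) (*-pos w>0 (prodℕ-pos b b>0))

prime∣∏dVec⇒ : ∀ {n p w} {b : Fin n → ℕ} → 2 ≤ n → Prime p → p ∣ prodℕ (dVec w b) → p ∣ w ℕ.* prodℕ b
prime∣∏dVec⇒ {w = w} {b} 2≤n pr p∣∏d =
  let j , p∣dj = to (prime∣prodℕ⇔ _ pr) p∣∏d in ∣-trans p∣dj (dVec∣w*prodℕ 2≤n w b j)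

-- The product formula for g

divAllButᵇ : ∀ {n} → (Fin n → ℕ) → ℕ → Fin n → ℕ → Bool
divAllButᵇ b w j p = all (λ i → divᵇ p (b i)) (others j) ∧ not (divᵇ p (b j ℕ.* w))

T-divAllButᵇ : ∀ {n} (b : Fin n → ℕ) w j p →
  T (divAllButᵇ b w j p) ⇔ ((∀ i → i ≢ j → p ∣ b i) × ¬ p ∣ b j ℕ.* w)
T-divAllButᵇ b w j p = mk⇔
  (λ t → let p∣others , p∤bw = to T-∧ t in
    (λ i i≢j → to T-divᵇ (to (All-others⇔ j) (All.all⁺ _ _ p∣others) i i≢j)) ,
    to (T-not-does (p ∣? _)) p∤bw)
  (λ (p∣others , p∤bw) → from T-∧
    (All.all⁻ _ (from (All-others⇔ j) λ i i≢j → from T-divᵇ (p∣others i i≢j)) ,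
     from (T-not-does (p ∣? _)) p∤bw))

module _ {n m} (S : Monomials n m) (2≤n : 2 ≤ n) {w : ℕ} {b : Fin n → ℕ}
         (gcd≡1 : gcdOver (λ _ → true) b ≡ 1) where

  private
    D : Fin n → ℕ
    D = dVec w b

  ¬prime∣all : ∀ {p} → Prime p → ¬ (∀ i → p ∣ b i)
  ¬prime∣all pr p∣b =
    ¬prime[1] (subst Prime (∣1⇒≡1 (subst (_ ∣_) gcd≡1 (from (∣gcdOver⇔ _ b) λ i _ → p∣b i))) pr)

  ∣allBut⇒∤ : ∀ {p j} → Prime p → (∀ i → i ≢ j → p ∣ b i) → ¬ p ∣ b j
  ∣allBut⇒∤ {p} {j} pr p∣others p∣bj = ¬prime∣all pr λ i → p∣b (i ≟ j)
    where
    p∣b : ∀ {i} → Dec (i ≡ j) → p ∣ b i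
    p∣b (yes refl)   = p∣bj
    p∣b {i} (no i≢j) = p∣others i i≢j

  module _ {p} (pr : Prime p) (p∤w : ¬ p ∣ w) where

    ∣dVec⇒ : ∀ {j} → p ∣ D j → ∀ i → i ≢ j → p ∣ b i
    ∣dVec⇒ {j} = [ ⊥-elim ∘ p∤w , id ]′ ∘ to (prime∣dVec⇔ w b j pr)

    ∣dVec-unique : ∀ {i j} → p ∣ D i → p ∣ D j → i ≡ j
    ∣dVec-unique {i} {j} p∣Di p∣Dj =
      decidable-stable (i ≟ j) λ i≢j → ∣allBut⇒∤ pr (∣dVec⇒ p∣Dj) (∣dVec⇒ p∣Di j (i≢j ∘ sym))

    T-divAllButᵇ⇔∣dVec : ∀ {j} → T (divAllButᵇ b w j p) ⇔ p ∣ D j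
    T-divAllButᵇ⇔∣dVec {j} = mk⇔
      (from (prime∣dVec⇔ w b j pr) ∘ inj₂ ∘ proj₁ ∘ to (T-divAllButᵇ b w j p))
      (λ p∣Dj → from (T-divAllButᵇ b w j p)
        (∣dVec⇒ p∣Dj , [ ∣allBut⇒∤ pr (∣dVec⇒ p∣Dj) , p∤w ]′ ∘ euclidsLemma (b j) w pr))

  SigTerm : ℕ → ℚ
  SigTerm p = if divᵇ p w then Sig S p else 1ℚ

  SigmTerm : Fin n → ℕ → ℚ
  SigmTerm j p = if divAllButᵇ b w j p then Sigm S j p else 1ℚ

  FFlocal-dVec : ∀ {p} → Prime p →
    FFlocal S D p ≡ SigTerm p * prodℚ (map (λ j → SigmTerm j p) (allFin n))
  FFlocal-dVec {p} pr = split (p ∣? w) (p ∣? prodℕ D)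
    where
    SigmTerms = prodℚ (map (λ j → SigmTerm j p) (allFin n))

    split : Dec (p ∣ w) → Dec (p ∣ prodℕ D) → FFlocal S D p ≡ SigTerm p * SigmTerms
    split (yes p∣w) _ = begin
      FFlocal S D p          ≡⟨ FFlocal-all S (λ j → ∣m⇒∣m*n _ p∣w) (Fin.fromℕ< (ℕₚ.<-trans (s≤s z≤n) 2≤n)) ⟩
      Sig S p                ≡⟨ ℚₚ.*-identityʳ _ ⟨
      Sig S p * 1ℚ           ≡⟨ cong₂ _*_ (if-T (from T-divᵇ p∣w)) (prodℚ-map-1 SigmTerm≡1 (allFin n)) ⟨
      SigTerm p * SigmTerms  ∎
      where
      SigmTerm≡1 : ∀ j → SigmTerm j p ≡ 1ℚ
      SigmTerm≡1 j = if-¬T λ t → proj₂ (to (T-divAllButᵇ b w j p) t) (∣n⇒∣m*n (b j) p∣w)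
    split (no p∤w) (yes p∣∏D) = begin
      FFlocal S D p          ≡⟨ FFlocal-single S (λ i → mk⇔ (λ p∣Di → ∣dVec-unique pr p∤w p∣Di p∣Dj)
                                                            λ { refl → p∣Dj }) ⟩
      Sigm S j p             ≡⟨ if-T (from (T-divAllButᵇ⇔∣dVec pr p∤w) p∣Dj) ⟨
      SigmTerm j p           ≡⟨ prodℚ-allFin-single (λ i → SigmTerm i p) j SigmTerm≡1 ⟨
      SigmTerms              ≡⟨ ℚₚ.*-identityˡ _ ⟨
      1ℚ * SigmTerms         ≡⟨ cong (_* SigmTerms) (if-¬T (p∤w ∘ to T-divᵇ)) ⟨
      SigTerm p * SigmTerms  ∎
      where
      j = proj₁ (to (prime∣prodℕ⇔ D pr) p∣∏D)
      p∣Dj = proj₂ (to (prime∣prodℕ⇔ D pr) p∣∏D)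
      SigmTerm≡1 : ∀ i → i ≢ j → SigmTerm i p ≡ 1ℚ
      SigmTerm≡1 i i≢j = if-¬T λ t → i≢j (∣dVec-unique pr p∤w (to (T-divAllButᵇ⇔∣dVec pr p∤w) t) p∣Dj)
    split (no p∤w) (no p∤∏D) = begin
      FFlocal S D p          ≡⟨ if-¬T (p∤∏D ∘ to T-divᵇ) ⟩
      1ℚ * 1ℚ                ≡⟨ cong₂ _*_ (if-¬T (p∤w ∘ to T-divᵇ)) (prodℚ-map-1 SigmTerm≡1 (allFin n)) ⟨
      SigTerm p * SigmTerms  ∎
      where
      SigmTerm≡1 : ∀ j → SigmTerm j p ≡ 1ℚ
      SigmTerm≡1 j = if-¬T λ t → p∤∏D (∣-trans (to (T-divAllButᵇ⇔∣dVec pr p∤w) t) (∣prodℕ D j))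

  SigEuler : ℕ → ℚ
  SigEuler = eulerFactor (λ p → divᵇ p w) (Sig S)

  SigmEuler : Fin n → ℕ → ℚ
  SigmEuler j = eulerFactor (divAllButᵇ b w j) (Sigm S j)

  FFeuler-dVec : ∀ p → FFeuler S D p ≡ SigEuler p * prodℚ (map (λ j → SigmEuler j p) (allFin n))
  FFeuler-dVec p with oddPrime? p
  ... | yes odd@(pr , _) = begin
    FFeuler S D p                                          ≡⟨ FFeuler-oddPrime S D odd ⟩
    FFlocal S D p                                          ≡⟨ FFlocal-dVec pr ⟩
    SigTerm p * prodℚ (map (λ j → SigmTerm j p) (allFin n))
      ≡⟨ cong₂ _*_ (eulerFactor-oddPrime (λ p → divᵇ p w) (Sig S) odd)
                   (prodℚ-map-cong (λ j → eulerFactor-oddPrime (divAllButᵇ b w j) (Sigm S j) odd) (allFin n)) ⟨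
    SigEuler p * prodℚ (map (λ j → SigmEuler j p) (allFin n)) ∎
  ... | no ¬odd = begin
    FFeuler S D p                                          ≡⟨ FFeuler-¬oddPrime S D ¬odd ⟩
    1ℚ * 1ℚ
      ≡⟨ cong₂ _*_ (eulerFactor-¬oddPrime (λ p → divᵇ p w) (Sig S) ¬odd)
                   (prodℚ-map-1 (λ j → eulerFactor-¬oddPrime (divAllButᵇ b w j) (Sigm S j) ¬odd) (allFin n)) ⟨
    SigEuler p * prodℚ (map (λ j → SigmEuler j p) (allFin n)) ∎

  FF-dVec : 0 < w → (∀ i → 0 < b i) →
    FF S D ≡ prodOddPrimes w (λ p → divᵇ p w) (Sig S)
           * prodℚ (map (λ j → prodOddPrimes (prodℕ b) (divAllButᵇ b w j) (Sigm S j)) (allFin n))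
  FF-dVec w>0 b>0 = begin
    FF S D
      ≡⟨ FF≡prodUpTo S N D (∏dVec-pos 2≤n w>0 b>0) ∏D≤N ⟩
    prodUpTo N (FFeuler S D)
      ≡⟨ prodℚ-map-cong FFeuler-dVec (upTo (suc N)) ⟩
    prodUpTo N (λ p → SigEuler p * SigmEulers p)
      ≡⟨ prodℚ-map-* SigEuler SigmEulers (upTo (suc N)) ⟩
    prodUpTo N SigEuler * prodUpTo N SigmEulers
      ≡⟨ cong (prodUpTo N SigEuler *_) (prodℚ-map-swap SigmEuler (allFin n) (upTo (suc N))) ⟨
    prodUpTo N SigEuler * prodℚ (map (λ j → prodUpTo N (SigmEuler j)) (allFin n))
      ≡⟨ cong₂ _*_ (prodOddPrimes≡prodUpTo N _ (Sig S) w-support w≤N)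
                   (prodℚ-map-cong (λ j → prodOddPrimes≡prodUpTo N _ (Sigm S j) (b-support j) ∏b≤N) (allFin n)) ⟨
    prodOddPrimes w (λ p → divᵇ p w) (Sig S)
      * prodℚ (map (λ j → prodOddPrimes (prodℕ b) (divAllButᵇ b w j) (Sigm S j)) (allFin n)) ∎
    where
    SigmEulers : ℕ → ℚ
    SigmEulers p = prodℚ (map (λ j → SigmEuler j p) (allFin n))

    N = prodℕ D ℕ.+ w ℕ.+ prodℕ b
    ∏D≤N : prodℕ D ≤ N
    ∏D≤N = ℕₚ.≤-trans (ℕₚ.m≤m+n _ _) (ℕₚ.m≤m+n _ _)
    w≤N : w ≤ N
    w≤N = ℕₚ.≤-trans (ℕₚ.m≤n+m _ (prodℕ D)) (ℕₚ.m≤m+n _ _)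
    ∏b≤N : prodℕ b ≤ N
    ∏b≤N = ℕₚ.m≤n+m _ (prodℕ D ℕ.+ w)

    w-support : ∀ p → T (divᵇ p w) → p ≤ w
    w-support p = ∣⇒≤ {{ℕ.>-nonZero w>0}} ∘ to T-divᵇ
    b-support : ∀ j p → T (divAllButᵇ b w j p) → p ≤ prodℕ b
    b-support j p t = let i , i≢j = other 2≤n j in
      ∣⇒≤ {{ℕ.>-nonZero (prodℕ-pos b b>0)}} (∣-trans (proj₁ (to (T-divAllButᵇ b w j p) t) i i≢j) (∣prodℕ b i))

  gg≡rhs : 0 < w → (∀ i → 0 < b i) → gg S w b ≡ rhs S w b
  gg≡rhs w>0 b>0 = begin
    FF S D * mu2 (2 ℕ.* w)   ≡⟨ cong (_* mu2 (2 ℕ.* w)) (FF-dVec w>0 b>0) ⟩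
    (A * B) * mu2 (2 ℕ.* w)  ≡⟨ ℚₚ.*-comm (A * B) _ ⟩
    mu2 (2 ℕ.* w) * (A * B)  ≡⟨ ℚₚ.*-assoc (mu2 (2 ℕ.* w)) A B ⟨
    mu2 (2 ℕ.* w) * A * B    ∎
    where
    A = prodOddPrimes w (λ p → divᵇ p w) (Sig S)
    B = prodℚ (map (λ j → prodOddPrimes (prodℕ b) (divAllButᵇ b w j) (Sigm S j)) (allFin n))

-- Multiplicativity

coprime⇒¬prime∣both : ∀ {p x y} → Coprime x y → Prime p → ¬ (p ∣ x × p ∣ y)
coprime⇒¬prime∣both x⊥y pr p∣x×y = ¬prime[1] (subst Prime (x⊥y p∣x×y) pr)

prime∣dVec-*⇔ : ∀ {n p} w w′ (b b′ : Fin n → ℕ) → Prime p →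
  ¬ (p ∣ w ℕ.* prodℕ b × p ∣ w′ ℕ.* prodℕ b′) → ∀ j →
  p ∣ dVec (w ℕ.* w′) (λ i → b i ℕ.* b′ i) j ⇔ (p ∣ dVec w b j ⊎ p ∣ dVec w′ b′ j)
prime∣dVec-*⇔ {p = p} w w′ b b′ pr no-common j =
  mk⇔ (split ∘ to (prime∣dVec⇔ (w ℕ.* w′) bb′ j pr)) (from (prime∣dVec⇔ (w ℕ.* w′) bb′ j pr) ∘ merge)
  where
  bb′ : Fin _ → ℕ
  bb′ i = b i ℕ.* b′ i
  split : p ∣ w ℕ.* w′ ⊎ (∀ i → i ≢ j → p ∣ b i ℕ.* b′ i) → p ∣ dVec w b j ⊎ p ∣ dVec w′ b′ j
  split (inj₁ p∣ww′) = Sum.map (from (prime∣dVec⇔ w b j pr) ∘ inj₁) (from (prime∣dVec⇔ w′ b′ j pr) ∘ inj₁)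
                               (euclidsLemma w w′ pr p∣ww′)
  split (inj₂ p∣bb′) with p ∣? w ℕ.* prodℕ b
  ... | yes p∣w∏b = inj₁ (from (prime∣dVec⇔ w b j pr) (inj₂ λ i i≢j →
          [ id , ⊥-elim ∘ p∤b′ i ]′ (euclidsLemma (b i) (b′ i) pr (p∣bb′ i i≢j))))
    where
    p∤b′ : ∀ i → ¬ p ∣ b′ i
    p∤b′ i p∣b′i = no-common (p∣w∏b , ∣n⇒∣m*n w′ (∣-trans p∣b′i (∣prodℕ b′ i)))
  ... | no p∤w∏b = inj₂ (from (prime∣dVec⇔ w′ b′ j pr) (inj₂ λ i i≢j →
          [ ⊥-elim ∘ p∤b i , id ]′ (euclidsLemma (b i) (b′ i) pr (p∣bb′ i i≢j))))
    where
    p∤b : ∀ i → ¬ p ∣ b i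
    p∤b i p∣bi = p∤w∏b (∣n⇒∣m*n w (∣-trans p∣bi (∣prodℕ b i)))
  merge : p ∣ dVec w b j ⊎ p ∣ dVec w′ b′ j → p ∣ w ℕ.* w′ ⊎ (∀ i → i ≢ j → p ∣ b i ℕ.* b′ i)
  merge (inj₁ p∣dj) =
    Sum.map (∣m⇒∣m*n w′) (λ p∣b i i≢j → ∣m⇒∣m*n (b′ i) (p∣b i i≢j)) (to (prime∣dVec⇔ w b j pr) p∣dj)
  merge (inj₂ p∣dj) =
    Sum.map (∣n⇒∣m*n w) (λ p∣b′ i i≢j → ∣n⇒∣m*n (b i) (p∣b′ i i≢j)) (to (prime∣dVec⇔ w′ b′ j pr) p∣dj)

FF-dVec-* : ∀ {n m} (S : Monomials n m) → 2 ≤ n → ∀ {w w′} {b b′ : Fin n → ℕ} →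
  0 < w → (∀ i → 0 < b i) → 0 < w′ → (∀ i → 0 < b′ i) → Coprime (w ℕ.* prodℕ b) (w′ ℕ.* prodℕ b′) →
  FF S (dVec (w ℕ.* w′) (λ i → b i ℕ.* b′ i)) ≡ FF S (dVec w b) * FF S (dVec w′ b′)
FF-dVec-* S 2≤n {w} {w′} {b} {b′} w>0 b>0 w′>0 b′>0 coprime =
  FF-* S _ _ _
    (∏dVec-pos 2≤n (*-pos w>0 w′>0) (λ i → *-pos (b>0 i) (b′>0 i)))
    (∏dVec-pos 2≤n w>0 b>0) (∏dVec-pos 2≤n w′>0 b′>0)
    (λ pr (p∣∏d , p∣∏d′) → coprime⇒¬prime∣both coprime pr
       (prime∣∏dVec⇒ {w = w} {b} 2≤n pr p∣∏d , prime∣∏dVec⇒ {w = w′} {b′} 2≤n pr p∣∏d′))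
    (λ pr → prime∣dVec-*⇔ w w′ b b′ pr (coprime⇒¬prime∣both coprime pr))

prime∤⇒coprime : ∀ {p n} → Prime p → ¬ p ∣ n → Coprime p n
prime∤⇒coprime pr p∤n (d∣p , d∣n) =
  [ id , (λ d≡p → contradiction (subst (_∣ _) d≡p d∣n) p∤n) ]′ (prime⇒irreducible pr d∣p)

coprime-*ˡ : ∀ {a b c} → Coprime a c → Coprime b c → Coprime (a ℕ.* b) c
coprime-*ˡ {a} {b} a⊥c b⊥c {d} (d∣ab , d∣c) =
  a⊥c (coprime-divisor d⊥b (subst (d ∣_) (ℕₚ.*-comm a b) d∣ab) , d∣c)
  where
  d⊥b : Coprime d b
  d⊥b (e∣d , e∣b) = b⊥c (e∣b , ∣-trans e∣d d∣c)

prime²⊥ : ∀ {p n} → Prime p → ¬ p ∣ n → Coprime (p ℕ.* p) n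
prime²⊥ pr p∤n = coprime-*ˡ (prime∤⇒coprime pr p∤n) (prime∤⇒coprime pr p∤n)

prime²∣*-split : ∀ {p a m n} → Prime p → Coprime m n →
  p ℕ.* p ∣ a ℕ.* (m ℕ.* n) → p ℕ.* p ∣ a ℕ.* m ⊎ p ℕ.* p ∣ a ℕ.* n
prime²∣*-split {p} {a} {m} {n} pr m⊥n p²∣amn with p ∣? n
... | no p∤n  = inj₁ (coprime-divisor (prime²⊥ pr p∤n) (subst (p ℕ.* p ∣_) (ℕ*.x∙yz≈z∙xy a m n) p²∣amn))
... | yes p∣n = inj₂ (coprime-divisor (prime²⊥ pr p∤m) (subst (p ℕ.* p ∣_) (ℕ*.x∙yz≈y∙xz a m n) p²∣amn))
  where
  p∤m : ¬ p ∣ m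
  p∤m p∣m = coprime⇒¬prime∣both m⊥n pr (p∣m , p∣n)

HasPrimeSquareFactor : ℕ → Set
HasPrimeSquareFactor x = ∃[ p ] Prime p × p ℕ.* p ∣ x

primeSquareFactor-∣ : ∀ {x y} → x ∣ y → HasPrimeSquareFactor x → HasPrimeSquareFactor y
primeSquareFactor-∣ x∣y (p , pr , p²∣x) = p , pr , ∣-trans p²∣x x∣y

primeSquareFactor-split : ∀ {a m n} → Coprime m n → HasPrimeSquareFactor (a ℕ.* (m ℕ.* n)) →
  HasPrimeSquareFactor (a ℕ.* m) ⊎ HasPrimeSquareFactor (a ℕ.* n)
primeSquareFactor-split {a} m⊥n (p , pr , p²∣amn) =
  Sum.map (λ p²∣am → p , pr , p²∣am) (λ p²∣an → p , pr , p²∣an) (prime²∣*-split {a = a} pr m⊥n p²∣amn)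

∃prime∣ : ∀ {d} → 2 ≤ d → ∃[ p ] Prime p × p ∣ d
∃prime∣ {d} 2≤d with factorise d {{ℕ.>-nonZero (ℕₚ.<-trans (s≤s z≤n) 2≤d)}}
... | record { factors = [] ; isFactorisation = d≡1 } = contradiction (subst (2 ≤_) d≡1 2≤d) λ { (s≤s ()) }
... | record { factors = p ∷ _ ; isFactorisation = d≡p*ps ; factorsPrime = pr ∷ _ } =
  p , pr , subst (p ∣_) (sym d≡p*ps) (m∣m*n _)

squareDivisorᵇ : ℕ → ℕ → Bool
squareDivisorᵇ x d = does (2 ℕ.≤? d) ∧ divᵇ (d ℕ.* d) x

hasSquareFactorᵇ : ℕ → Bool
hasSquareFactorᵇ x = any (squareDivisorᵇ x) (upTo (suc x))

T-hasSquareFactorᵇ : ∀ {x} → 0 < x → T (hasSquareFactorᵇ x) ⇔ HasPrimeSquareFactor x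
T-hasSquareFactorᵇ {x} x>0 = mk⇔ square⇒prime² prime²⇒square
  where
  square⇒prime² : T (hasSquareFactorᵇ x) → HasPrimeSquareFactor x
  square⇒prime² t =
    let d , _ , t′ = find (Any.any⁻ (squareDivisorᵇ x) (upTo (suc x)) t)
        2≤d , d²∣x = to (T-∧ {does (2 ℕ.≤? d)}) t′
        p , pr , p∣d = ∃prime∣ (to (T-does (2 ℕ.≤? d)) 2≤d)
    in p , pr , ∣-trans (*-pres-∣ p∣d p∣d) (to T-divᵇ d²∣x)
  prime²⇒square : HasPrimeSquareFactor x → T (hasSquareFactorᵇ x)
  prime²⇒square (p , pr , p²∣x) =
    Any.any⁺ (squareDivisorᵇ x) (lose (∈-upTo⁺ (s≤s p≤x)) (from (T-∧ {does (2 ℕ.≤? p)}) (2≤p , from T-divᵇ p²∣x)))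
    where
    2≤p = from (T-does (2 ℕ.≤? p)) (ℕ.nonTrivial⇒n>1 p {{prime⇒nonTrivial pr}})
    p≤x : p ≤ x
    p≤x = ℕₚ.≤-trans (ℕₚ.m≤m*n p p {{prime⇒nonZero pr}}) (∣⇒≤ {{ℕ.>-nonZero x>0}} p²∣x)

hasSquareFactorᵇ-* : ∀ {a m n} → 0 < a → 0 < m → 0 < n → Coprime m n →
  hasSquareFactorᵇ (a ℕ.* (m ℕ.* n)) ≡ hasSquareFactorᵇ (a ℕ.* m) ∨ hasSquareFactorᵇ (a ℕ.* n)
hasSquareFactorᵇ-* {a} {m} {n} a>0 m>0 n>0 m⊥n = T-injective (mk⇔
  (from (T-∨ {hasSquareFactorᵇ (a ℕ.* m)}) ∘ Sum.map (from (T-sq am>0)) (from (T-sq an>0))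
    ∘ primeSquareFactor-split {a} m⊥n ∘ to (T-sq amn>0))
  (from (T-sq amn>0) ∘ [ primeSquareFactor-∣ (*-monoʳ-∣ a (m∣m*n n)) ∘ to (T-sq am>0)
                       , primeSquareFactor-∣ (*-monoʳ-∣ a (n∣m*n m)) ∘ to (T-sq an>0) ]′
    ∘ to (T-∨ {hasSquareFactorᵇ (a ℕ.* m)})))
  where
  T-sq = T-hasSquareFactorᵇ
  am>0 = *-pos a>0 m>0
  an>0 = *-pos a>0 n>0
  amn>0 = *-pos a>0 (*-pos m>0 n>0)

mu2-* : ∀ {a m n} → 0 < a → 0 < m → 0 < n → Coprime m n →
  mu2 (a ℕ.* (m ℕ.* n)) ≡ mu2 (a ℕ.* m) * mu2 (a ℕ.* n)
mu2-* {a} {m} {n} a>0 m>0 n>0 m⊥n =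
  trans (cong indicator (hasSquareFactorᵇ-* a>0 m>0 n>0 m⊥n)) (indicator-∨ (hasSquareFactorᵇ (a ℕ.* m)) _)
  where
  indicator : Bool → ℚ
  indicator c = if c then 0ℚ else 1ℚ
  indicator-∨ : ∀ c c′ → indicator (c ∨ c′) ≡ indicator c * indicator c′
  indicator-∨ false false = refl
  indicator-∨ false true  = refl
  indicator-∨ true  false = refl
  indicator-∨ true  true  = refl

gg-* : ∀ {n m} (S : Monomials n m) → 2 ≤ n → ∀ {w w′} {b b′ : Fin n → ℕ} →
  0 < w → (∀ i → 0 < b i) → 0 < w′ → (∀ i → 0 < b′ i) → Coprime (w ℕ.* prodℕ b) (w′ ℕ.* prodℕ b′) →
  gg S (w ℕ.* w′) (λ i → b i ℕ.* b′ i) ≡ gg S w b * gg S w′ b′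
gg-* S 2≤n {w} {w′} {b} {b′} w>0 b>0 w′>0 b′>0 coprime = begin
  FF S (dVec (w ℕ.* w′) _) * mu2 (2 ℕ.* (w ℕ.* w′))
    ≡⟨ cong₂ _*_ (FF-dVec-* S 2≤n w>0 b>0 w′>0 b′>0 coprime) (mu2-* {a = 2} (s≤s z≤n) w>0 w′>0 w⊥w′) ⟩
  (FF S (dVec w b) * FF S (dVec w′ b′)) * (mu2 (2 ℕ.* w) * mu2 (2 ℕ.* w′))
    ≡⟨ interchange (FF S (dVec w b)) (FF S (dVec w′ b′)) (mu2 (2 ℕ.* w)) (mu2 (2 ℕ.* w′)) ⟩
  (FF S (dVec w b) * mu2 (2 ℕ.* w)) * (FF S (dVec w′ b′) * mu2 (2 ℕ.* w′)) ∎
  where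
  w⊥w′ : Coprime w w′
  w⊥w′ (d∣w , d∣w′) = coprime (∣m⇒∣m*n (prodℕ b) d∣w , ∣m⇒∣m*n (prodℕ b′) d∣w′)

lemma4p5 : (n m : ℕ) → 2 ≤ n → 1 ≤ m → (S : Monomials n m) → PairwiseCoprime S →
    (w : ℕ) (b : Fin n → ℕ) → 0 < w → (∀ i → 0 < b i) → gcdOver (λ _ → true) b ≡ 1 →
    (gg S w b ≡ rhs S w b)
    × ((w' : ℕ) (b' : Fin n → ℕ) → 0 < w' → (∀ i → 0 < b' i) → gcdOver (λ _ → true) b' ≡ 1 →
       Coprime (w Data.Nat.* prodℕ b) (w' Data.Nat.* prodℕ b') →
       gg S (w Data.Nat.* w') (λ i → b i Data.Nat.* b' i) ≡ gg S w b * gg S w' b')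
lemma4p5 n m 2≤n _ S _ w b w>0 b>0 gcd≡1 =
  gg≡rhs S 2≤n gcd≡1 w>0 b>0 ,
  λ w′ b′ w′>0 b′>0 _ coprime → gg-* S 2≤n w>0 b>0 w′>0 b′>0 coprime
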